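{- Let $a$ be a point of $AG(4,3)$. Given any four $a$-lines whose corresponding lines through $a$ do not all lie in a common hyperplane, there are exactly eight demicaps (with anchor $a$) that contain these eight points.
   Context: $AG(4,3)=\mathbb{F}_3^4$ with lines the triples of distinct points $x,y,z$ with $x+y+z=0$. A cap is a set of points containing no line. A hyperplane is a 3-dimensional affine subspace. For a point $a$, an $a$-line is a pair $\{b,c\}$ with $\{a,b,c\}$ a line. A demicap with anchor point $a$ is a cap consisting of five $a$-lines such that no four of the corresponding lines through $a$ lie in a common hyperplane. -}

module Defs where

open import Data.Nat using (ℕ)
open import Data.Fin using (Fin; zero; suc)
open import Data.Vec using (Vec; []; _∷_; zipWith; replicate; map)
open import Data.Bool using (Bool; true)
open import Data.Product using (Σ; ∃; _×_; _,_)
open import Data.Sum using (_⊎_)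
open import Data.Empty using (⊥)
open import Relation.Nullary using (¬_)
open import Relation.Binary.PropositionalEquality using (_≡_; _≢_)

F3 : Set
F3 = Fin 3

_⊕_ : F3 → F3 → F3
zero ⊕ y = y
suc zero ⊕ zero = suc zero
suc zero ⊕ suc zero = suc (suc zero)
suc zero ⊕ suc (suc zero) = zero
suc (suc zero) ⊕ zero = suc (suc zero)
suc (suc zero) ⊕ suc zero = zero
suc (suc zero) ⊕ suc (suc zero) = suc zero

_⊗_ : F3 → F3 → F3
zero ⊗ y = zero
suc zero ⊗ y = y
suc (suc zero) ⊗ zero = zero
suc (suc zero) ⊗ suc zero = suc (suc zero)
suc (suc zero) ⊗ suc (suc zero) = suc zero

Point : Set
Point = Vec F3 4

_+ₚ_ : Point → Point → Point
_+ₚ_ = zipWith _⊕_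

_·ₚ_ : F3 → Point → Point
s ·ₚ x = map (s ⊗_) x

0ₚ : Point
0ₚ = replicate 4 zero

IsLine : Point → Point → Point → Set
IsLine x y z = x ≢ y × y ≢ z × x ≢ z × ((x +ₚ y) +ₚ z) ≡ 0ₚ

-- Sets of points (compared extensionally, pointwise).
PSet : Set
PSet = Point → Bool

_∈_ : Point → PSet → Set
x ∈ S = S x ≡ true

IsCap : PSet → Set
IsCap S = ∀ x y z → IsLine x y z → x ∈ S → y ∈ S → z ∈ S → ⊥

record Hyperplane : Set where
  constructor hyp
  field
    base : Point
    u v w : Point
    indep : ∀ (s t r : F3) →
            ((s ·ₚ u) +ₚ (t ·ₚ v)) +ₚ (r ·ₚ w) ≡ 0ₚ →
            (s ≡ zero) × (t ≡ zero) × (r ≡ zero)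

_∈H_ : Point → Hyperplane → Set
x ∈H H = ∃ λ (s : F3) → ∃ λ (t : F3) → ∃ λ (r : F3) →
  x ≡ base +ₚ (((s ·ₚ u) +ₚ (t ·ₚ v)) +ₚ (r ·ₚ w))
  where open Hyperplane H

-- a-lines: a pair {b,c} such that {a,b,c} is a line.
-- Represented by an ordered pair (b , c) with IsLine a b c.

ALine : Point → Set
ALine a = Σ (Point × Point) λ { (b , c) → IsLine a b c }

LineIn : (a : Point) → ALine a → Hyperplane → Set
LineIn a ((b , c) , _) H = a ∈H H × b ∈H H × c ∈H H

fstPt sndPt : {a : Point} → ALine a → Point
fstPt ((b , c) , _) = b
sndPt ((b , c) , _) = c

IsUnionOf : {a : Point} {n : ℕ} → PSet → (Fin n → ALine a) → Set
IsUnionOf {a} {n} S L =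
  ∀ x → (x ∈ S → ∃ λ i → (x ≡ fstPt (L i)) ⊎ (x ≡ sndPt (L i)))
      × (∀ i → (x ≡ fstPt (L i)) ⊎ (x ≡ sndPt (L i)) → x ∈ S)

-- Demicap with anchor a: a cap consisting of five a-lines such that no
-- four of the corresponding lines through a lie in a common hyperplane
-- (i.e. for every index m, the four lines with index ≠ m do not all lie
-- in one hyperplane).

IsDemicap : Point → PSet → Set
IsDemicap a S =
  IsCap S ×
  Σ (Fin 5 → ALine a) λ L →
    IsUnionOf S L ×
    (∀ (m : Fin 5) → ¬ (Σ Hyperplane λ H → ∀ i → i ≢ m → LineIn a (L i) H))

NotCoHyperplanar4 : (a : Point) → (Fin 4 → ALine a) → Set
NotCoHyperplanar4 a L = ¬ (Σ Hyperplane λ H → ∀ i → LineIn a (L i) H)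

ContainsAll : {a : Point} → (Fin 4 → ALine a) → PSet → Set
ContainsAll L S = ∀ i → fstPt (L i) ∈ S × sndPt (L i) ∈ S

_≐_ : PSet → PSet → Set
S ≐ T = ∀ x → S x ≡ T x

-- "There are exactly n sets S (up to extensional equality) satisfying P",
-- for P respecting ≐ : an injective enumeration D : Fin n → PSet of
-- pairwise distinct sets satisfying P, covering every set satisfying P.
ExactlyN : ℕ → (PSet → Set) → Set
ExactlyN n P =
  Σ (Fin n → PSet) λ D →
    (∀ i j → i ≢ j → ¬ (D i ≐ D j)) ×
    (∀ i → P (D i)) ×
    (∀ S → P S → ∃ λ i → S ≐ D i)

Fin4ALines : Point → Set
Fin4ALines a = Fin 4 → ALine a

-- Let bₖ be the direction of the k-th given a-line. A nonzero linear form vanishing on every bₖ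
-- would have, as its kernel through a, a hyperplane containing the four lines; so b₀, …, b₃ is a
-- basis and φ c = a + Σ cₖ bₖ is an affine bijection F₃⁴ → AG(4,3), preserving lines and taking the
-- given a-lines to the axes ±eₖ. In these coordinates a demicap through the eight points is the
-- union of the four axes and one more a-line ±c. No coordinate cₖ vanishes, for otherwise the
-- coordinate hyperplane through a would contain the four lines other than the k-th axis; this
-- leaves the eight lines ±c with c ∈ {±1}⁴. Conversely each of them gives a demicap: the ten points
-- form a cap (checked by computation), and since any four of e₀, …, e₃, c span F₃⁴, a hyperplane
-- through a containing four of the five lines would contain all five, the given four among them.

module Submission where

open import Defs
open import Data.Product using (_×_)

open import Data.Bool using (true)
open import Data.Bool.Properties using (⇔→≡)
open import Data.Empty using (⊥-elim)
open import Data.Fin using (Fin; zero; suc; punchIn; punchOut; combine; remQuot)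
open import Data.Fin.Patterns using (0F; 1F; 2F; 3F; 4F; 5F; 6F; 7F)
open import Data.Fin.Properties
  using (all?; any?; pigeonhole; punchOut-injective; punchInᵢ≢i; remQuot-combine; combine-remQuot; <⇒≢)
  renaming (_≟_ to _≟F_)
open import Data.Nat using (ℕ; _^_)
open import Data.Nat.Properties using (n<1+n)
open import Data.Product using (Σ; ∃; _,_; proj₁; proj₂)
open import Data.Sum using (_⊎_; inj₁; inj₂)
open import Data.Vec using (Vec; []; _∷_; lookup; tabulate; zipWith; map; replicate)
open import Data.Vec.Properties using (≡-dec; ∷-injective; lookup∘tabulate; tabulate-cong)
open import Function using (_∘_; mk⇔)
open import Function.Definitions using (Injective; StrictlySurjective)
open import Relation.Binary.PropositionalEquality
open import Relation.Nullary using (Dec; yes; no; ¬_; does)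
open import Relation.Nullary.Decidable using (from-yes; dec-true; map′; _×-dec_; _⊎-dec_; _→-dec_; ¬?)

pattern ⟨_,_,_,_⟩ x₁ x₂ x₃ x₄ = x₁ ∷ x₂ ∷ x₃ ∷ x₄ ∷ []

-- Defs' _+ₚ_, _·ₚ_ and 0ₚ are the instances n = 4 of the following; negation is scaling by 2 = -1.

infixl 6 _+ᵛ_
infixr 7 _·ᵛ_
infix 8 -ᵛ_

_+ᵛ_ : ∀ {n} → Vec F3 n → Vec F3 n → Vec F3 n
_+ᵛ_ = zipWith _⊕_

_·ᵛ_ : ∀ {n} → F3 → Vec F3 n → Vec F3 n
s ·ᵛ x = map (s ⊗_) x

-ᵛ_ : ∀ {n} → Vec F3 n → Vec F3 n
-ᵛ x = 2F ·ᵛ x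

0ᵛ : ∀ {n} → Vec F3 n
0ᵛ = replicate _ 0F

infix 4 _≟ᵛ_
_≟ᵛ_ : ∀ {n} (x y : Vec F3 n) → Dec (x ≡ y)
_≟ᵛ_ = ≡-dec _≟F_

+ᵛ-identityˡ : ∀ {n} (x : Vec F3 n) → 0ᵛ +ᵛ x ≡ x
+ᵛ-identityˡ [] = refl
+ᵛ-identityˡ (x ∷ xs) = cong (x ∷_) (+ᵛ-identityˡ xs)

+ᵛ-identityʳ : ∀ {n} (x : Vec F3 n) → x +ᵛ 0ᵛ ≡ x
+ᵛ-identityʳ [] = refl
+ᵛ-identityʳ (x ∷ xs) =
  cong₂ _∷_ (from-yes (all? λ x → x ⊕ 0F ≟F x) x) (+ᵛ-identityʳ xs)

+ᵛ-assoc : ∀ {n} (x y z : Vec F3 n) → (x +ᵛ y) +ᵛ z ≡ x +ᵛ (y +ᵛ z)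
+ᵛ-assoc [] [] [] = refl
+ᵛ-assoc (x ∷ xs) (y ∷ ys) (z ∷ zs) =
  cong₂ _∷_ (from-yes (all? λ x → all? λ y → all? λ z → (x ⊕ y) ⊕ z ≟F x ⊕ (y ⊕ z)) x y z)
            (+ᵛ-assoc xs ys zs)

+ᵛ-cancelˡ : ∀ {n} (p : Vec F3 n) {x y} → p +ᵛ x ≡ p +ᵛ y → x ≡ y
+ᵛ-cancelˡ [] {[]} {[]} _ = refl
+ᵛ-cancelˡ (p ∷ ps) {x ∷ xs} {y ∷ ys} eq =
  cong₂ _∷_ (from-yes (all? λ p → all? λ x → all? λ y → p ⊕ x ≟F p ⊕ y →-dec x ≟F y) p x y
                      (proj₁ (∷-injective eq)))
            (+ᵛ-cancelˡ ps (proj₂ (∷-injective eq)))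

·ᵛ-zeroˡ : ∀ {n} (x : Vec F3 n) → 0F ·ᵛ x ≡ 0ᵛ
·ᵛ-zeroˡ [] = refl
·ᵛ-zeroˡ (x ∷ xs) = cong (0F ∷_) (·ᵛ-zeroˡ xs)

·ᵛ-zeroʳ : ∀ {n} (s : F3) → s ·ᵛ 0ᵛ {n} ≡ 0ᵛ
·ᵛ-zeroʳ {ℕ.zero} s = refl
·ᵛ-zeroʳ {ℕ.suc n} s = cong₂ _∷_ (from-yes (all? λ s → s ⊗ 0F ≟F 0F) s) (·ᵛ-zeroʳ s)

·ᵛ-identityˡ : ∀ {n} (x : Vec F3 n) → 1F ·ᵛ x ≡ x
·ᵛ-identityˡ [] = refl
·ᵛ-identityˡ (x ∷ xs) = cong (x ∷_) (·ᵛ-identityˡ xs)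

-ᵛ-involutive : ∀ {n} (x : Vec F3 n) → -ᵛ -ᵛ x ≡ x
-ᵛ-involutive [] = refl
-ᵛ-involutive (x ∷ xs) =
  cong₂ _∷_ (from-yes (all? λ x → 2F ⊗ (2F ⊗ x) ≟F x) x) (-ᵛ-involutive xs)

+ᵛ-inverseʳ : ∀ {n} (x : Vec F3 n) → x +ᵛ -ᵛ x ≡ 0ᵛ
+ᵛ-inverseʳ [] = refl
+ᵛ-inverseʳ (x ∷ xs) =
  cong₂ _∷_ (from-yes (all? λ x → x ⊕ (2F ⊗ x) ≟F 0F) x) (+ᵛ-inverseʳ xs)

+ᵛ-inverse⇒≡ : ∀ {n} {x y : Vec F3 n} → x +ᵛ -ᵛ y ≡ 0ᵛ → x ≡ y
+ᵛ-inverse⇒≡ {x = []} {[]} _ = refl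
+ᵛ-inverse⇒≡ {x = x ∷ xs} {y ∷ ys} eq =
  cong₂ _∷_ (from-yes (all? λ x → all? λ y → x ⊕ (2F ⊗ y) ≟F 0F →-dec x ≟F y) x y
                      (proj₁ (∷-injective eq)))
            (+ᵛ-inverse⇒≡ (proj₂ (∷-injective eq)))

≡-ᵛ⇒≡0 : ∀ {n} {x : Vec F3 n} → x ≡ -ᵛ x → x ≡ 0ᵛ
≡-ᵛ⇒≡0 {x = []} _ = refl
≡-ᵛ⇒≡0 {x = x ∷ xs} eq =
  cong₂ _∷_ (from-yes (all? λ x → x ≟F 2F ⊗ x →-dec x ≟F 0F) x (proj₁ (∷-injective eq)))
            (≡-ᵛ⇒≡0 (proj₂ (∷-injective eq)))

line-third : ∀ {n} {x y z : Vec F3 n} → (x +ᵛ y) +ᵛ z ≡ 0ᵛ → z ≡ -ᵛ (x +ᵛ y)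
line-third {x = []} {[]} {[]} _ = refl
line-third {x = x ∷ xs} {y ∷ ys} {z ∷ zs} eq =
  cong₂ _∷_ (from-yes (all? λ x → all? λ y → all? λ z →
                         (x ⊕ y) ⊕ z ≟F 0F →-dec z ≟F 2F ⊗ (x ⊕ y)) x y z (proj₁ (∷-injective eq)))
            (line-third (proj₂ (∷-injective eq)))

translate-back : ∀ {n} (p x : Vec F3 n) → p +ᵛ (x +ᵛ -ᵛ p) ≡ x
translate-back [] [] = refl
translate-back (p ∷ ps) (x ∷ xs) =
  cong₂ _∷_ (from-yes (all? λ p → all? λ x → p ⊕ (x ⊕ (2F ⊗ p)) ≟F x) p x) (translate-back ps xs)

-ᵛ-translate-twice : ∀ {n} (p x : Vec F3 n) → -ᵛ (p +ᵛ (p +ᵛ x)) ≡ p +ᵛ -ᵛ x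
-ᵛ-translate-twice [] [] = refl
-ᵛ-translate-twice (p ∷ ps) (x ∷ xs) =
  cong₂ _∷_ (from-yes (all? λ p → all? λ x → 2F ⊗ (p ⊕ (p ⊕ x)) ≟F p ⊕ (2F ⊗ x)) p x)
            (-ᵛ-translate-twice ps xs)

-ᵛ-translate-sum : ∀ {n} (p x y : Vec F3 n) → -ᵛ ((p +ᵛ x) +ᵛ (p +ᵛ y)) ≡ p +ᵛ -ᵛ (x +ᵛ y)
-ᵛ-translate-sum [] [] [] = refl
-ᵛ-translate-sum (p ∷ ps) (x ∷ xs) (y ∷ ys) =
  cong₂ _∷_ (from-yes (all? λ p → all? λ x → all? λ y →
                         2F ⊗ ((p ⊕ x) ⊕ (p ⊕ y)) ≟F p ⊕ (2F ⊗ (x ⊕ y))) p x y)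
            (-ᵛ-translate-sum ps xs ys)

translate-sum₃ : ∀ {n} (p x y z : Vec F3 n) → ((p +ᵛ x) +ᵛ (p +ᵛ y)) +ᵛ (p +ᵛ z) ≡ (x +ᵛ y) +ᵛ z
translate-sum₃ [] [] [] [] = refl
translate-sum₃ (p ∷ ps) (x ∷ xs) (y ∷ ys) (z ∷ zs) =
  cong₂ _∷_ (from-yes (all? λ p → all? λ x → all? λ y → all? λ z →
                         ((p ⊕ x) ⊕ (p ⊕ y)) ⊕ (p ⊕ z) ≟F (x ⊕ y) ⊕ z) p x y z)
            (translate-sum₃ ps xs ys zs)

·ᵛ-+ᵛ-interchange : ∀ {n} s t (u x y : Vec F3 n) →
                    (s ⊕ t) ·ᵛ u +ᵛ (x +ᵛ y) ≡ (s ·ᵛ u +ᵛ x) +ᵛ (t ·ᵛ u +ᵛ y)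
·ᵛ-+ᵛ-interchange s t [] [] [] = refl
·ᵛ-+ᵛ-interchange s t (u ∷ us) (x ∷ xs) (y ∷ ys) =
  cong₂ _∷_ (from-yes (all? λ s → all? λ t → all? λ u → all? λ x → all? λ y →
                         ((s ⊕ t) ⊗ u) ⊕ (x ⊕ y) ≟F ((s ⊗ u) ⊕ x) ⊕ ((t ⊗ u) ⊕ y)) s t u x y)
            (·ᵛ-+ᵛ-interchange s t us xs ys)

·ᵛ-distrib-+ᵛ : ∀ {n} s t (u x : Vec F3 n) → s ·ᵛ (t ·ᵛ u +ᵛ x) ≡ (s ⊗ t) ·ᵛ u +ᵛ s ·ᵛ x
·ᵛ-distrib-+ᵛ s t [] [] = refl
·ᵛ-distrib-+ᵛ s t (u ∷ us) (x ∷ xs) =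
  cong₂ _∷_ (from-yes (all? λ s → all? λ t → all? λ u → all? λ x →
                         s ⊗ ((t ⊗ u) ⊕ x) ≟F ((s ⊗ t) ⊗ u) ⊕ (s ⊗ x)) s t u x)
            (·ᵛ-distrib-+ᵛ s t us xs)

dot : ∀ {n} → Vec F3 n → Vec F3 n → F3
dot [] [] = 0F
dot (x ∷ xs) (y ∷ ys) = (x ⊗ y) ⊕ dot xs ys

dot-0ˡ : ∀ {n} (x : Vec F3 n) → dot 0ᵛ x ≡ 0F
dot-0ˡ [] = refl
dot-0ˡ (x ∷ xs) = dot-0ˡ xs

dot-0ʳ : ∀ {n} (f : Vec F3 n) → dot f 0ᵛ ≡ 0F
dot-0ʳ [] = refl
dot-0ʳ (f ∷ fs) = trans (cong ((f ⊗ 0F) ⊕_) (dot-0ʳ fs)) (from-yes (all? λ f → (f ⊗ 0F) ⊕ 0F ≟F 0F) f)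

dot-+ʳ : ∀ {n} (f x y : Vec F3 n) → dot f (x +ᵛ y) ≡ dot f x ⊕ dot f y
dot-+ʳ [] [] [] = refl
dot-+ʳ (f ∷ fs) (x ∷ xs) (y ∷ ys) =
  trans (cong ((f ⊗ (x ⊕ y)) ⊕_) (dot-+ʳ fs xs ys))
        (from-yes (all? λ f → all? λ x → all? λ y → all? λ A → all? λ B →
                     (f ⊗ (x ⊕ y)) ⊕ (A ⊕ B) ≟F ((f ⊗ x) ⊕ A) ⊕ ((f ⊗ y) ⊕ B)) f x y _ _)

dot-·ʳ : ∀ {n} (f : Vec F3 n) s x → dot f (s ·ᵛ x) ≡ s ⊗ dot f x
dot-·ʳ [] s [] = from-yes (all? λ s → 0F ≟F s ⊗ 0F) s
dot-·ʳ (f ∷ fs) s (x ∷ xs) =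
  trans (cong ((f ⊗ (s ⊗ x)) ⊕_) (dot-·ʳ fs s xs))
        (from-yes (all? λ f → all? λ s → all? λ x → all? λ A →
                     (f ⊗ (s ⊗ x)) ⊕ (s ⊗ A) ≟F s ⊗ ((f ⊗ x) ⊕ A)) f s x _)

dot-+ˡ : ∀ {n} (f g x : Vec F3 n) → dot (f +ᵛ g) x ≡ dot f x ⊕ dot g x
dot-+ˡ [] [] [] = refl
dot-+ˡ (f ∷ fs) (g ∷ gs) (x ∷ xs) =
  trans (cong (((f ⊕ g) ⊗ x) ⊕_) (dot-+ˡ fs gs xs))
        (from-yes (all? λ f → all? λ g → all? λ x → all? λ A → all? λ B →
                     ((f ⊕ g) ⊗ x) ⊕ (A ⊕ B) ≟F ((f ⊗ x) ⊕ A) ⊕ ((g ⊗ x) ⊕ B)) f g x _ _)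

dot-·ˡ : ∀ {n} s (f x : Vec F3 n) → dot (s ·ᵛ f) x ≡ s ⊗ dot f x
dot-·ˡ s [] [] = from-yes (all? λ s → 0F ≟F s ⊗ 0F) s
dot-·ˡ s (f ∷ fs) (x ∷ xs) =
  trans (cong (((s ⊗ f) ⊗ x) ⊕_) (dot-·ˡ s fs xs))
        (from-yes (all? λ s → all? λ f → all? λ x → all? λ A →
                     ((s ⊗ f) ⊗ x) ⊕ (s ⊗ A) ≟F s ⊗ ((f ⊗ x) ⊕ A)) s f x _)

-- Test against 1 ∷ 0 for the head and against 0 ∷ y for the tail.
dot-nondegenerate : ∀ {n} {c c′ : Vec F3 n} → (∀ y → dot c y ≡ dot c′ y) → c ≡ c′
dot-nondegenerate {c = []} {[]} _ = refl
dot-nondegenerate {c = x ∷ c} {x′ ∷ c′} same = cong₂ _∷_ heads (dot-nondegenerate tails)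
  where
  heads : x ≡ x′
  heads = from-yes (all? λ x → all? λ x′ → (x ⊗ 1F) ⊕ 0F ≟F (x′ ⊗ 1F) ⊕ 0F →-dec x ≟F x′) x x′
            (subst₂ (λ A B → (x ⊗ 1F) ⊕ A ≡ (x′ ⊗ 1F) ⊕ B) (dot-0ʳ c) (dot-0ʳ c′) (same (1F ∷ 0ᵛ)))
  tails : ∀ y → dot c y ≡ dot c′ y
  tails y = from-yes (all? λ x → all? λ x′ → all? λ A → all? λ B →
                        (x ⊗ 0F) ⊕ A ≟F (x′ ⊗ 0F) ⊕ B →-dec A ≟F B) x x′ _ _ (same (0F ∷ y))

e : ∀ {n} → Fin n → Vec F3 n
e zero = 1F ∷ 0ᵛ
e (suc k) = 0F ∷ e k

dot-e : ∀ {n} (c : Vec F3 n) k → dot c (e k) ≡ lookup c k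
dot-e (x ∷ c) zero =
  trans (cong ((x ⊗ 1F) ⊕_) (dot-0ʳ c)) (from-yes (all? λ x → (x ⊗ 1F) ⊕ 0F ≟F x) x)
dot-e (x ∷ c) (suc k) =
  trans (from-yes (all? λ x → all? λ A → (x ⊗ 0F) ⊕ A ≟F A) x _) (dot-e c k)

lincomb : ∀ {m n} → Vec F3 m → (Fin m → Vec F3 n) → Vec F3 n
lincomb [] v = 0ᵛ
lincomb (s ∷ c) v = s ·ᵛ v zero +ᵛ lincomb c (v ∘ suc)

lincomb-0 : ∀ {m n} (v : Fin m → Vec F3 n) → lincomb 0ᵛ v ≡ 0ᵛ
lincomb-0 {ℕ.zero} v = refl
lincomb-0 {ℕ.suc m} v =
  trans (cong₂ _+ᵛ_ (·ᵛ-zeroˡ (v zero)) (lincomb-0 (v ∘ suc))) (+ᵛ-identityˡ 0ᵛ)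

lincomb-+ : ∀ {m n} (c d : Vec F3 m) (v : Fin m → Vec F3 n) →
            lincomb (c +ᵛ d) v ≡ lincomb c v +ᵛ lincomb d v
lincomb-+ [] [] v = sym (+ᵛ-identityˡ 0ᵛ)
lincomb-+ (s ∷ c) (t ∷ d) v =
  trans (cong ((s ⊕ t) ·ᵛ v zero +ᵛ_) (lincomb-+ c d (v ∘ suc)))
        (·ᵛ-+ᵛ-interchange s t (v zero) _ _)

lincomb-· : ∀ {m n} s (c : Vec F3 m) (v : Fin m → Vec F3 n) →
            lincomb (s ·ᵛ c) v ≡ s ·ᵛ lincomb c v
lincomb-· s [] v = sym (·ᵛ-zeroʳ s)
lincomb-· s (t ∷ c) v =
  trans (cong ((s ⊗ t) ·ᵛ v zero +ᵛ_) (lincomb-· s c (v ∘ suc)))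
        (sym (·ᵛ-distrib-+ᵛ s t (v zero) _))

lincomb-e : ∀ {m n} (k : Fin m) (v : Fin m → Vec F3 n) → lincomb (e k) v ≡ v k
lincomb-e zero v =
  trans (cong₂ _+ᵛ_ (·ᵛ-identityˡ (v zero)) (lincomb-0 (v ∘ suc))) (+ᵛ-identityʳ (v zero))
lincomb-e (suc k) v =
  trans (cong₂ _+ᵛ_ (·ᵛ-zeroˡ (v zero)) (lincomb-e k (v ∘ suc))) (+ᵛ-identityˡ (v (suc k)))

dot-lincomb : ∀ {m n} (f : Vec F3 n) (c : Vec F3 m) (v : Fin m → Vec F3 n) →
              dot f (lincomb c v) ≡ dot c (tabulate (λ k → dot f (v k)))
dot-lincomb f [] v = dot-0ʳ f
dot-lincomb f (s ∷ c) v = begin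
  dot f (s ·ᵛ v zero +ᵛ lincomb c (v ∘ suc))       ≡⟨ dot-+ʳ f _ _ ⟩
  dot f (s ·ᵛ v zero) ⊕ dot f (lincomb c (v ∘ suc)) ≡⟨ cong₂ _⊕_ (dot-·ʳ f s (v zero)) (dot-lincomb f c (v ∘ suc)) ⟩
  (s ⊗ dot f (v zero)) ⊕ dot c (tabulate (λ k → dot f (v (suc k)))) ∎
  where open ≡-Reasoning

affine : ∀ {m n} → Vec F3 n → (Fin m → Vec F3 n) → Vec F3 m → Vec F3 n
affine p v c = p +ᵛ lincomb c v

affine-0 : ∀ {m n} (p : Vec F3 n) (v : Fin m → Vec F3 n) → affine p v 0ᵛ ≡ p
affine-0 p v = trans (cong (p +ᵛ_) (lincomb-0 v)) (+ᵛ-identityʳ p)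

affine-third : ∀ {m n} (p : Vec F3 n) (v : Fin m → Vec F3 n) c c′ →
               -ᵛ (affine p v c +ᵛ affine p v c′) ≡ affine p v (-ᵛ (c +ᵛ c′))
affine-third p v c c′ = begin
  -ᵛ ((p +ᵛ lincomb c v) +ᵛ (p +ᵛ lincomb c′ v)) ≡⟨ -ᵛ-translate-sum p _ _ ⟩
  p +ᵛ -ᵛ (lincomb c v +ᵛ lincomb c′ v)           ≡⟨ cong (λ x → p +ᵛ -ᵛ x) (sym (lincomb-+ c c′ v)) ⟩
  p +ᵛ -ᵛ lincomb (c +ᵛ c′) v                     ≡⟨ cong (p +ᵛ_) (sym (lincomb-· 2F (c +ᵛ c′) v)) ⟩
  p +ᵛ lincomb (-ᵛ (c +ᵛ c′)) v                   ∎
  where open ≡-Reasoning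

affine-sum₃ : ∀ {m n} (p : Vec F3 n) (v : Fin m → Vec F3 n) c₁ c₂ c₃ →
              (affine p v c₁ +ᵛ affine p v c₂) +ᵛ affine p v c₃ ≡ lincomb ((c₁ +ᵛ c₂) +ᵛ c₃) v
affine-sum₃ p v c₁ c₂ c₃ = begin
  ((p +ᵛ lincomb c₁ v) +ᵛ (p +ᵛ lincomb c₂ v)) +ᵛ (p +ᵛ lincomb c₃ v) ≡⟨ translate-sum₃ p _ _ _ ⟩
  (lincomb c₁ v +ᵛ lincomb c₂ v) +ᵛ lincomb c₃ v ≡⟨ cong (_+ᵛ lincomb c₃ v) (sym (lincomb-+ c₁ c₂ v)) ⟩
  lincomb (c₁ +ᵛ c₂) v +ᵛ lincomb c₃ v           ≡⟨ sym (lincomb-+ (c₁ +ᵛ c₂) c₃ v) ⟩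
  lincomb ((c₁ +ᵛ c₂) +ᵛ c₃) v                   ∎
  where open ≡-Reasoning

-- Over F3 these are exactly the affine subspaces; through 0ᵛ, the linear ones.
LineClosed : ∀ {n} → (Vec F3 n → Set) → Set
LineClosed P = ∀ x y → P x → P y → P (-ᵛ (x +ᵛ y))

affine-preimage-lineClosed : ∀ {m n} {P : Vec F3 n → Set} (p : Vec F3 n) (v : Fin m → Vec F3 n) →
                             LineClosed P → LineClosed (P ∘ affine p v)
affine-preimage-lineClosed {P = P} p v closed c c′ Pc Pc′ =
  subst P (affine-third p v c c′) (closed _ _ Pc Pc′)

module _ {n} {P : Vec F3 n → Set} (closed : LineClosed P) (P0 : P 0ᵛ) where

  lineClosed-neg : ∀ {x} → P x → P (-ᵛ x)
  lineClosed-neg {x} Px = subst (λ y → P (-ᵛ y)) (+ᵛ-identityʳ x) (closed x 0ᵛ Px P0)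

  lineClosed-+ : ∀ {x y} → P x → P y → P (x +ᵛ y)
  lineClosed-+ {x} {y} Px Py =
    subst P (-ᵛ-involutive (x +ᵛ y)) (lineClosed-neg (closed x y Px Py))

  lineClosed-· : ∀ s {x} → P x → P (s ·ᵛ x)
  lineClosed-· 0F {x} _ = subst P (sym (·ᵛ-zeroˡ x)) P0
  lineClosed-· 1F {x} Px = subst P (sym (·ᵛ-identityˡ x)) Px
  lineClosed-· 2F Px = lineClosed-neg Px

  lineClosed-lincomb : ∀ {m} (c : Vec F3 m) {v} → (∀ k → P (v k)) → P (lincomb c v)
  lineClosed-lincomb [] _ = P0
  lineClosed-lincomb (s ∷ c) Pv = lineClosed-+ (lineClosed-· s (Pv zero)) (lineClosed-lincomb c (Pv ∘ suc))

spanning : Hyperplane → Fin 3 → Point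
spanning H = lookup (u ∷ v ∷ w ∷ [])
  where open Hyperplane H

combination₃≡lincomb : ∀ {n} s t r (u v w : Vec F3 n) →
                       (s ·ᵛ u +ᵛ t ·ᵛ v) +ᵛ r ·ᵛ w ≡ lincomb (s ∷ t ∷ r ∷ []) (lookup (u ∷ v ∷ w ∷ []))
combination₃≡lincomb s t r u v w = begin
  (s ·ᵛ u +ᵛ t ·ᵛ v) +ᵛ r ·ᵛ w         ≡⟨ +ᵛ-assoc _ _ _ ⟩
  s ·ᵛ u +ᵛ (t ·ᵛ v +ᵛ r ·ᵛ w)         ≡⟨ cong (λ y → s ·ᵛ u +ᵛ (t ·ᵛ v +ᵛ y)) (sym (+ᵛ-identityʳ _)) ⟩
  s ·ᵛ u +ᵛ (t ·ᵛ v +ᵛ (r ·ᵛ w +ᵛ 0ᵛ)) ∎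
  where open ≡-Reasoning

∈H⇒affine : ∀ {x} H → x ∈H H → ∃ λ c → x ≡ affine (Hyperplane.base H) (spanning H) c
∈H⇒affine H (s , t , r , x≡) =
  s ∷ t ∷ r ∷ [] , trans x≡ (cong (Hyperplane.base H +ᵛ_) (combination₃≡lincomb s t r _ _ _))

affine⇒∈H : ∀ {x} H c → x ≡ affine (Hyperplane.base H) (spanning H) c → x ∈H H
affine⇒∈H H (s ∷ t ∷ r ∷ []) x≡ =
  s , t , r , trans x≡ (cong (Hyperplane.base H +ᵛ_) (sym (combination₃≡lincomb s t r _ _ _)))

∈H-lineClosed : ∀ H → LineClosed (_∈H H)
∈H-lineClosed H _ _ x∈ y∈ with ∈H⇒affine H x∈ | ∈H⇒affine H y∈
... | c , refl | c′ , refl =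
  affine⇒∈H H (-ᵛ (c +ᵛ c′)) (affine-third (Hyperplane.base H) (spanning H) c c′)

all?ᵛ : ∀ {m n} {P : Vec (Fin m) n → Set} → (∀ x → Dec (P x)) → Dec (∀ x → P x)
all?ᵛ {n = ℕ.zero} P? = map′ (λ { p [] → p }) (λ p → p []) (P? [])
all?ᵛ {n = ℕ.suc n} P? =
  map′ (λ { p (x ∷ xs) → p x xs }) (λ p x xs → p (x ∷ xs)) (all? λ x → all?ᵛ λ xs → P? (x ∷ xs))

any?ᵛ : ∀ {m n} {P : Vec (Fin m) n → Set} → (∀ x → Dec (P x)) → Dec (∃ P)
any?ᵛ {n = ℕ.zero} P? = map′ ([] ,_) (λ { ([] , p) → p }) (P? [])
any?ᵛ {n = ℕ.suc n} P? =
  map′ (λ { (x , xs , p) → x ∷ xs , p }) (λ { (x ∷ xs , p) → x , xs , p })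
       (any? λ x → any?ᵛ λ xs → P? (x ∷ xs))

does⇒witness : ∀ {A : Set} (a? : Dec A) → does a? ≡ true → A
does⇒witness (yes a) _ = a

toFin : ∀ {m n} → Vec (Fin m) n → Fin (m ^ n)
toFin [] = zero
toFin (x ∷ xs) = combine x (toFin xs)

fromFin : ∀ {m n} → Fin (m ^ n) → Vec (Fin m) n
fromFin {n = ℕ.zero} _ = []
fromFin {m} {ℕ.suc n} i = proj₁ (remQuot {m} (m ^ n) i) ∷ fromFin (proj₂ (remQuot {m} (m ^ n) i))

fromFin-toFin : ∀ {m n} (xs : Vec (Fin m) n) → fromFin (toFin xs) ≡ xs
fromFin-toFin [] = refl
fromFin-toFin {m} {ℕ.suc n} (x ∷ xs) =
  cong₂ _∷_ (cong proj₁ split) (trans (cong (fromFin ∘ proj₂) split) (fromFin-toFin xs))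
  where split = remQuot-combine {m} {m ^ n} x (toFin xs)

toFin-fromFin : ∀ {m n} (i : Fin (m ^ n)) → toFin {m} {n} (fromFin i) ≡ i
toFin-fromFin {n = ℕ.zero} zero = refl
toFin-fromFin {m} {ℕ.suc n} i =
  trans (cong (combine (proj₁ (remQuot {m} (m ^ n) i))) (toFin-fromFin {m} {n} (proj₂ (remQuot {m} (m ^ n) i))))
        (combine-remQuot {m} (m ^ n) i)

no-injection-into-smaller : ∀ {n} (f : Fin (ℕ.suc n) → Fin n) → ¬ Injective _≡_ _≡_ f
no-injection-into-smaller {n} f f-inj with pigeonhole (n<1+n n) f
... | i , j , i<j , fi≡fj = <⇒≢ i<j (f-inj fi≡fj)

-- Opaque, like the exhaustively decided facts below, so that conversion checking never unfolds
-- their searches.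
opaque
  injective⇒surjective : ∀ {n} (f : Fin n → Fin n) → Injective _≡_ _≡_ f → StrictlySurjective _≡_ f
  injective⇒surjective {ℕ.suc n} f f-inj y with any? (λ x → f x ≟F y)
  ... | yes hit = hit
  ... | no miss = ⊥-elim (no-injection-into-smaller (λ x → punchOut (miss ∘ (x ,_) ∘ sym))
                            (f-inj ∘ punchOut-injective {i = y} _ _))

  vec-injective⇒surjective : ∀ {m n} (f : Vec (Fin m) n → Vec (Fin m) n) →
                             Injective _≡_ _≡_ f → StrictlySurjective _≡_ f
  vec-injective⇒surjective {m} {n} f f-inj y with injective⇒surjective (toFin ∘ f ∘ fromFin) g-inj (toFin y)
    where
    g-inj : Injective _≡_ _≡_ (toFin ∘ f ∘ fromFin)
    g-inj {i} {j} eq = begin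
      i                          ≡⟨ sym (toFin-fromFin {m} {n} i) ⟩
      toFin {m} {n} (fromFin i)  ≡⟨ cong toFin (f-inj (begin
        f (fromFin i)                    ≡⟨ sym (fromFin-toFin _) ⟩
        fromFin (toFin (f (fromFin i)))  ≡⟨ cong fromFin eq ⟩
        fromFin (toFin (f (fromFin j)))  ≡⟨ fromFin-toFin _ ⟩
        f (fromFin j)                    ∎)) ⟩
      toFin {m} {n} (fromFin j)  ≡⟨ toFin-fromFin {m} {n} j ⟩
      j                          ∎
      where open ≡-Reasoning
  ... | i , eq = fromFin i , trans (sym (fromFin-toFin _)) (trans (cong fromFin eq) (fromFin-toFin y))

  injection-coversAllButOne : ∀ {n} (g : Fin n → Fin (ℕ.suc n)) → Injective _≡_ _≡_ g →
                              ∃ λ r → ∀ j → j ≢ r → ∃ λ k → g k ≡ j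
  injection-coversAllButOne {n} g g-inj with any? (λ r → all? λ k → ¬? (g k ≟F r))
  ... | yes (r , r∉) = r , hit
    where
    h : Fin n → Fin n
    h k = punchOut (r∉ k ∘ sym)
    hit : ∀ j → j ≢ r → ∃ λ k → g k ≡ j
    hit j j≢r with injective⇒surjective h (g-inj ∘ punchOut-injective {i = r} _ _) (punchOut (j≢r ∘ sym))
    ... | k , hk≡ = k , punchOut-injective {i = r} _ _ hk≡
  ... | no all-hit = ⊥-elim (no-injection-into-smaller preimage
                               (λ {r} {r′} eq → trans (sym (preimage-spec r)) (trans (cong g eq) (preimage-spec r′))))
    where
    hit : ∀ r → Dec (∃ λ k → g k ≡ r) → ∃ λ k → g k ≡ r
    hit r (yes p) = p
    hit r (no ¬p) = ⊥-elim (all-hit (r , λ k gk≡r → ¬p (k , gk≡r)))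
    preimage : Fin (ℕ.suc n) → Fin n
    preimage r = proj₁ (hit r (any? λ k → g k ≟F r))
    preimage-spec : ∀ r → g (preimage r) ≡ r
    preimage-spec r = proj₂ (hit r (any? λ k → g k ≟F r))

-- The kernel of a nonzero linear form on F3⁴ is a hyperplane through 0

combination : F3 → F3 → F3 → Point × Point × Point → Point
combination s t r (u , v , w) = s ·ᵛ u +ᵛ t ·ᵛ v +ᵛ r ·ᵛ w

-- Pivot on the first nonzero coordinate hₚ, using hₚ⁻¹ = hₚ; the junk value at h = 0 is never used.
kernelBasis : Point → Point × Point × Point
kernelBasis ⟨ 0F , 0F , 0F , _ ⟩ =
  ⟨ 1F , 0F , 0F , 0F ⟩ , ⟨ 0F , 1F , 0F , 0F ⟩ , ⟨ 0F , 0F , 1F , 0F ⟩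
kernelBasis ⟨ 0F , 0F , h₃ , h₄ ⟩ =
  ⟨ 1F , 0F , 0F , 0F ⟩ , ⟨ 0F , 1F , 0F , 0F ⟩ , ⟨ 0F , 0F , 2F ⊗ (h₃ ⊗ h₄) , 1F ⟩
kernelBasis ⟨ 0F , h₂ , h₃ , h₄ ⟩ =
  ⟨ 1F , 0F , 0F , 0F ⟩ , ⟨ 0F , 2F ⊗ (h₂ ⊗ h₃) , 1F , 0F ⟩ , ⟨ 0F , 2F ⊗ (h₂ ⊗ h₄) , 0F , 1F ⟩
kernelBasis ⟨ h₁ , h₂ , h₃ , h₄ ⟩ =
  ⟨ 2F ⊗ (h₁ ⊗ h₂) , 1F , 0F , 0F ⟩ , ⟨ 2F ⊗ (h₁ ⊗ h₃) , 0F , 1F , 0F ⟩ , ⟨ 2F ⊗ (h₁ ⊗ h₄) , 0F , 0F , 1F ⟩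

opaque
  kernelBasis-independent : ∀ h → h ≢ 0ᵛ → ∀ s t r → combination s t r (kernelBasis h) ≡ 0ᵛ →
                            (s ≡ 0F) × (t ≡ 0F) × (r ≡ 0F)
  kernelBasis-independent = from-yes
    (all?ᵛ λ h → ¬? (h ≟ᵛ 0ᵛ) →-dec all? λ s → all? λ t → all? λ r →
       combination s t r (kernelBasis h) ≟ᵛ 0ᵛ →-dec
       ((s ≟F 0F) ×-dec (t ≟F 0F) ×-dec (r ≟F 0F)))

  kernelBasis-spans : ∀ h x → h ≢ 0ᵛ → dot h x ≡ 0F →
                      ∃ λ s → ∃ λ t → ∃ λ r → x ≡ combination s t r (kernelBasis h)
  kernelBasis-spans = from-yes
    (all?ᵛ λ h → all?ᵛ λ x → ¬? (h ≟ᵛ 0ᵛ) →-dec dot h x ≟F 0F →-dec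
       any? λ s → any? λ t → any? λ r → x ≟ᵛ combination s t r (kernelBasis h))

kernelHyperplane : (p h : Point) → h ≢ 0ᵛ → Hyperplane
kernelHyperplane p h h≢0 = hyp p u v w (kernelBasis-independent h h≢0)
  where
  u v w : Point
  u = proj₁ (kernelBasis h)
  v = proj₁ (proj₂ (kernelBasis h))
  w = proj₂ (proj₂ (kernelBasis h))

∈-kernelHyperplane : ∀ p h (h≢0 : h ≢ 0ᵛ) {x} → dot h x ≡ 0F → (p +ᵛ x) ∈H kernelHyperplane p h h≢0
∈-kernelHyperplane p h h≢0 {x} hx≡0 with kernelBasis-spans h x h≢0 hx≡0
... | s , t , r , x≡ = s , t , r , cong (p +ᵛ_) x≡

aLine-in-kernelHyperplane : ∀ {a h} (h≢0 : h ≢ 0ᵛ) (l : ALine a) {x} →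
                            fstPt l ≡ a +ᵛ x → dot h x ≡ 0F → LineIn a l (kernelHyperplane a h h≢0)
aLine-in-kernelHyperplane {a} {h} h≢0 ((y , z) , _ , _ , _ , a+y+z≡0) {x} y≡ hx≡0 =
  subst (_∈H H) (+ᵛ-identityʳ a) (∈-kernelHyperplane a h h≢0 (dot-0ʳ h)) ,
  subst (_∈H H) (sym y≡) (∈-kernelHyperplane a h h≢0 hx≡0) ,
  subst (_∈H H) (sym z≡) (∈-kernelHyperplane a h h≢0 (trans (dot-·ʳ h 2F x) (cong (2F ⊗_) hx≡0)))
  where
  H = kernelHyperplane a h h≢0
  z≡ : z ≡ a +ᵛ -ᵛ x
  z≡ = trans (line-third a+y+z≡0) (trans (cong (λ y → -ᵛ (a +ᵛ y)) y≡) (-ᵛ-translate-twice a x))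

infix 4 _≡±_
_≡±_ : ∀ {n} → Vec F3 n → Vec F3 n → Set
c ≡± d = c ≡ d ⊎ c ≡ -ᵛ d

infix 4 _≡±?_
_≡±?_ : ∀ {n} (c d : Vec F3 n) → Dec (c ≡± d)
c ≡±? d = (c ≟ᵛ d) ⊎-dec (c ≟ᵛ -ᵛ d)

≡±-sym : ∀ {n} {c d : Vec F3 n} → c ≡± d → d ≡± c
≡±-sym (inj₁ refl) = inj₁ refl
≡±-sym (inj₂ refl) = inj₂ (sym (-ᵛ-involutive _))

≡±-trans : ∀ {n} {c d f : Vec F3 n} → c ≡± d → d ≡± f → c ≡± f
≡±-trans (inj₁ refl) d≡±f = d≡±f
≡±-trans (inj₂ refl) (inj₁ refl) = inj₂ refl
≡±-trans (inj₂ refl) (inj₂ refl) = inj₁ (-ᵛ-involutive _)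

signed : ∀ {n} → Fin 2 → Vec F3 n → Vec F3 n
signed 0F c = c
signed 1F c = -ᵛ c

≡±⇒signed : ∀ {n} {c d : Vec F3 n} → c ≡± d → ∃ λ σ → c ≡ signed σ d
≡±⇒signed (inj₁ c≡d) = 0F , c≡d
≡±⇒signed (inj₂ c≡-d) = 1F , c≡-d

-- One vector from each of the eight pairs ±c of vectors with no zero coordinate.
ν : Fin 8 → Point
ν 0F = ⟨ 1F , 1F , 1F , 1F ⟩
ν 1F = ⟨ 1F , 1F , 1F , 2F ⟩
ν 2F = ⟨ 1F , 1F , 2F , 1F ⟩
ν 3F = ⟨ 1F , 1F , 2F , 2F ⟩
ν 4F = ⟨ 1F , 2F , 1F , 1F ⟩
ν 5F = ⟨ 1F , 2F , 1F , 2F ⟩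
ν 6F = ⟨ 1F , 2F , 2F , 1F ⟩
ν 7F = ⟨ 1F , 2F , 2F , 2F ⟩

-- The directions of the five a-lines of the i-th demicap, in coordinates.
κ : Fin 8 → Fin 5 → Point
κ i zero = ν i
κ i (suc k) = e k

opaque
  κ-nonzero : ∀ i j → κ i j ≢ 0ᵛ
  κ-nonzero = from-yes (all? λ i → all? λ j → ¬? (κ i j ≟ᵛ 0ᵛ))

  κ-spanning : ∀ i m → ∃ λ t → κ i m ≡ lincomb t (κ i ∘ punchIn m)
  κ-spanning = from-yes (all? λ i → all? λ m → any?ᵛ λ t → κ i m ≟ᵛ lincomb t (κ i ∘ punchIn m))

  κ-signed-cap : ∀ i m₁ m₂ m₃ σ₁ σ₂ σ₃ →
    signed σ₁ (κ i m₁) ≢ signed σ₂ (κ i m₂) → signed σ₂ (κ i m₂) ≢ signed σ₃ (κ i m₃) →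
    signed σ₁ (κ i m₁) ≢ signed σ₃ (κ i m₃) →
    (signed σ₁ (κ i m₁) +ᵛ signed σ₂ (κ i m₂)) +ᵛ signed σ₃ (κ i m₃) ≢ 0ᵛ
  κ-signed-cap = from-yes
    (all? λ i → all? λ m₁ → all? λ m₂ → all? λ m₃ → all? λ σ₁ → all? λ σ₂ → all? λ σ₃ →
       ¬? (signed σ₁ (κ i m₁) ≟ᵛ signed σ₂ (κ i m₂)) →-dec
       ¬? (signed σ₂ (κ i m₂) ≟ᵛ signed σ₃ (κ i m₃)) →-dec
       ¬? (signed σ₁ (κ i m₁) ≟ᵛ signed σ₃ (κ i m₃)) →-dec
       ¬? ((signed σ₁ (κ i m₁) +ᵛ signed σ₂ (κ i m₂)) +ᵛ signed σ₃ (κ i m₃) ≟ᵛ 0ᵛ))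

  ν-separated : ∀ i i′ → i ≢ i′ → ∀ m → ¬ (ν i ≡± κ i′ m)
  ν-separated = from-yes (all? λ i → all? λ i′ → ¬? (i ≟F i′) →-dec all? λ m → ¬? (ν i ≡±? κ i′ m))

  ν-cover : ∀ c → (∀ k → lookup c k ≢ 0F) → ∃ λ i → c ≡± ν i
  ν-cover = from-yes (all?ᵛ λ c → (all? λ k → ¬? (lookup c k ≟F 0F)) →-dec any? λ i → c ≡±? ν i)

  e-≡±-injective : ∀ (k k′ : Fin 4) → e k ≡± e k′ → k ≡ k′
  e-≡±-injective = from-yes (all? λ (k : Fin 4) → all? λ k′ → e k ≡±? e k′ →-dec k ≟F k′)

  e-nonzero : ∀ (k : Fin 4) → e k ≢ 0ᵛ
  e-nonzero = from-yes (all? λ (k : Fin 4) → ¬? (e k ≟ᵛ 0ᵛ))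

  ≡±e-lookup : ∀ {c} (k k′ : Fin 4) → c ≡± e k → k ≢ k′ → lookup c k′ ≡ 0F
  ≡±e-lookup k k′ (inj₁ refl) =
    from-yes (all? λ (k : Fin 4) → all? λ k′ → ¬? (k ≟F k′) →-dec lookup (e k) k′ ≟F 0F) k k′
  ≡±e-lookup k k′ (inj₂ refl) =
    from-yes (all? λ (k : Fin 4) → all? λ k′ → ¬? (k ≟F k′) →-dec lookup (-ᵛ e k) k′ ≟F 0F) k k′

κ-cap : ∀ i {d₁ d₂ d₃} → (∃ λ m → d₁ ≡± κ i m) → (∃ λ m → d₂ ≡± κ i m) → (∃ λ m → d₃ ≡± κ i m) →
        d₁ ≢ d₂ → d₂ ≢ d₃ → d₁ ≢ d₃ → (d₁ +ᵛ d₂) +ᵛ d₃ ≢ 0ᵛ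
κ-cap i (m₁ , d₁≡±) (m₂ , d₂≡±) (m₃ , d₃≡±)
  with ≡±⇒signed d₁≡± | ≡±⇒signed d₂≡± | ≡±⇒signed d₃≡±
... | σ₁ , refl | σ₂ , refl | σ₃ , refl = κ-signed-cap i m₁ m₂ m₃ σ₁ σ₂ σ₃

-- Affine coordinates adapted to four a-lines not in a common hyperplane

module Frame (a : Point) (L : Fin4ALines a) (nch : NotCoHyperplanar4 a L) where

  b : Fin 4 → Point
  b k = fstPt (L k) +ᵛ -ᵛ a

  φ : Point → Point
  φ = affine a b

  fstPt-L : ∀ k → fstPt (L k) ≡ a +ᵛ b k
  fstPt-L k = sym (translate-back a (fstPt (L k)))

  -- The transpose of the linear part of φ.
  T : Point → Point
  T f = tabulate (λ k → dot f (b k))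

  T-coordinate : ∀ {f g} → T f ≡ T g → ∀ k → dot f (b k) ≡ dot g (b k)
  T-coordinate {f} {g} Tf≡Tg k =
    trans (sym (lookup∘tabulate (λ k → dot f (b k)) k))
          (trans (cong (λ t → lookup t k) Tf≡Tg) (lookup∘tabulate (λ k → dot g (b k)) k))

  -- A nonzero vector in the kernel of T is a linear form vanishing on every bₖ, whose kernel
  -- through a would be a hyperplane containing all four lines.
  T-injective : Injective _≡_ _≡_ T
  T-injective {f} {g} Tf≡Tg with f +ᵛ -ᵛ g ≟ᵛ 0ᵛ
  ... | yes f-g≡0 = +ᵛ-inverse⇒≡ f-g≡0
  ... | no f-g≢0 = ⊥-elim (nch (kernelHyperplane a (f +ᵛ -ᵛ g) f-g≢0 ,
                                λ k → aLine-in-kernelHyperplane f-g≢0 (L k) (fstPt-L k) (vanishes k)))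
    where
    vanishes : ∀ k → dot (f +ᵛ -ᵛ g) (b k) ≡ 0F
    vanishes k = begin
      dot (f +ᵛ -ᵛ g) (b k)               ≡⟨ dot-+ˡ f (-ᵛ g) (b k) ⟩
      dot f (b k) ⊕ dot (-ᵛ g) (b k)      ≡⟨ cong₂ _⊕_ (T-coordinate {f} {g} Tf≡Tg k) (dot-·ˡ 2F g (b k)) ⟩
      dot g (b k) ⊕ (2F ⊗ dot g (b k))    ≡⟨ from-yes (all? λ x → x ⊕ (2F ⊗ x) ≟F 0F) (dot g (b k)) ⟩
      0F                                  ∎
      where open ≡-Reasoning

  T-surjective : StrictlySurjective _≡_ T
  T-surjective = vec-injective⇒surjective T T-injective

  linear-injective : Injective _≡_ _≡_ (λ c → lincomb c b)
  linear-injective {c} {c′} eq = dot-nondegenerate λ y → let f , Tf≡y = T-surjective y in begin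
    dot c y                 ≡⟨ cong (dot c) (sym Tf≡y) ⟩
    dot c (T f)             ≡⟨ sym (dot-lincomb f c b) ⟩
    dot f (lincomb c b)     ≡⟨ cong (dot f) eq ⟩
    dot f (lincomb c′ b)    ≡⟨ dot-lincomb f c′ b ⟩
    dot c′ (T f)            ≡⟨ cong (dot c′) Tf≡y ⟩
    dot c′ y                ∎
    where open ≡-Reasoning

  φ-injective : Injective _≡_ _≡_ φ
  φ-injective = linear-injective ∘ +ᵛ-cancelˡ a

  φ-surjective : StrictlySurjective _≡_ φ
  φ-surjective x with vec-injective⇒surjective (λ c → lincomb c b) linear-injective (x +ᵛ -ᵛ a)
  ... | c , eq = c , trans (cong (a +ᵛ_) eq) (translate-back a x)

  φ-0 : φ 0ᵛ ≡ a
  φ-0 = affine-0 a b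

  φ-e : ∀ k → φ (e k) ≡ fstPt (L k)
  φ-e k = trans (cong (a +ᵛ_) (lincomb-e k b)) (sym (fstPt-L k))

  φ-reflects-lines : ∀ {c₁ c₂ c₃} → (φ c₁ +ᵛ φ c₂) +ᵛ φ c₃ ≡ 0ᵛ → (c₁ +ᵛ c₂) +ᵛ c₃ ≡ 0ᵛ
  φ-reflects-lines {c₁} {c₂} {c₃} sum≡0 =
    linear-injective (trans (sym (affine-sum₃ a b c₁ c₂ c₃)) (trans sum≡0 (sym (lincomb-0 b))))

  sndPt-φ : (l : ALine a) {c : Point} → fstPt l ≡ φ c → sndPt l ≡ φ (-ᵛ c)
  sndPt-φ ((x , y) , _ , _ , _ , a+x+y≡0) {c} x≡φc = begin
    y                     ≡⟨ line-third a+x+y≡0 ⟩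
    -ᵛ (a +ᵛ x)           ≡⟨ cong₂ (λ p q → -ᵛ (p +ᵛ q)) (sym φ-0) x≡φc ⟩
    -ᵛ (φ 0ᵛ +ᵛ φ c)      ≡⟨ affine-third a b 0ᵛ c ⟩
    φ (-ᵛ (0ᵛ +ᵛ c))      ≡⟨ cong (λ d → φ (-ᵛ d)) (+ᵛ-identityˡ c) ⟩
    φ (-ᵛ c)              ∎
    where open ≡-Reasoning

  aLine : (c : Point) → c ≢ 0ᵛ → ALine a
  aLine c c≢0 = (φ c , φ (-ᵛ c)) , a≢φc , φc≢φ-c , a≢φ-c , sum≡0
    where
    a≢φc : a ≢ φ c
    a≢φc a≡φc = c≢0 (sym (φ-injective {0ᵛ} {c} (trans φ-0 a≡φc)))
    φc≢φ-c : φ c ≢ φ (-ᵛ c)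
    φc≢φ-c = c≢0 ∘ ≡-ᵛ⇒≡0 ∘ φ-injective {c} { -ᵛ c}
    a≢φ-c : a ≢ φ (-ᵛ c)
    a≢φ-c a≡φ-c = c≢0 (begin
      c           ≡⟨ sym (-ᵛ-involutive c) ⟩
      -ᵛ -ᵛ c     ≡⟨ cong -ᵛ_ (sym (φ-injective {0ᵛ} { -ᵛ c} (trans φ-0 a≡φ-c))) ⟩
      -ᵛ 0ᵛ       ≡⟨ ·ᵛ-zeroʳ {4} 2F ⟩
      0ᵛ          ∎)
      where open ≡-Reasoning
    sum≡0 : (a +ᵛ φ c) +ᵛ φ (-ᵛ c) ≡ 0ᵛ
    sum≡0 = begin
      (a +ᵛ φ c) +ᵛ φ (-ᵛ c)          ≡⟨ cong (λ p → (p +ᵛ φ c) +ᵛ φ (-ᵛ c)) (sym φ-0) ⟩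
      (φ 0ᵛ +ᵛ φ c) +ᵛ φ (-ᵛ c)       ≡⟨ affine-sum₃ a b 0ᵛ c (-ᵛ c) ⟩
      lincomb ((0ᵛ +ᵛ c) +ᵛ -ᵛ c) b   ≡⟨ cong (λ d → lincomb (d +ᵛ -ᵛ c) b) (+ᵛ-identityˡ c) ⟩
      lincomb (c +ᵛ -ᵛ c) b           ≡⟨ cong (λ d → lincomb d b) (+ᵛ-inverseʳ c) ⟩
      lincomb 0ᵛ b                    ≡⟨ lincomb-0 b ⟩
      0ᵛ                              ∎
      where open ≡-Reasoning

  OnLine : Point → Point → Set
  OnLine x c = x ≡ φ c ⊎ x ≡ φ (-ᵛ c)

  OnLine? : ∀ x c → Dec (OnLine x c)
  OnLine? x c = (x ≟ᵛ φ c) ⊎-dec (x ≟ᵛ φ (-ᵛ c))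

  OnLine-≡± : ∀ {x c d} → c ≡± d → OnLine x c → OnLine x d
  OnLine-≡± (inj₁ refl) on = on
  OnLine-≡± (inj₂ refl) (inj₁ x≡) = inj₂ x≡
  OnLine-≡± {d = d} (inj₂ refl) (inj₂ x≡) = inj₁ (trans x≡ (cong φ (-ᵛ-involutive d)))

  OnLine-φ : ∀ {c d} → OnLine (φ d) c → d ≡± c
  OnLine-φ {c} {d} (inj₁ eq) = inj₁ (φ-injective {d} {c} eq)
  OnLine-φ {c} {d} (inj₂ eq) = inj₂ (φ-injective {d} { -ᵛ c} eq)

  OnLine-coordinates : ∀ {x c} → OnLine x c → ∃ λ d → x ≡ φ d × d ≡± c
  OnLine-coordinates {c = c} (inj₁ x≡) = c , x≡ , inj₁ refl
  OnLine-coordinates {c = c} (inj₂ x≡) = -ᵛ c , x≡ , inj₂ refl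

  aLine⇒OnLine : (l : ALine a) {c : Point} → fstPt l ≡ φ c →
                 ∀ {x} → (x ≡ fstPt l) ⊎ (x ≡ sndPt l) → OnLine x c
  aLine⇒OnLine l fst≡ (inj₁ x≡) = inj₁ (trans x≡ fst≡)
  aLine⇒OnLine l {c} fst≡ (inj₂ x≡) = inj₂ (trans x≡ (sndPt-φ l {c} fst≡))

  OnLine⇒aLine : (l : ALine a) {c : Point} → fstPt l ≡ φ c →
                 ∀ {x} → OnLine x c → (x ≡ fstPt l) ⊎ (x ≡ sndPt l)
  OnLine⇒aLine l fst≡ (inj₁ x≡) = inj₁ (trans x≡ (sym fst≡))
  OnLine⇒aLine l {c} fst≡ (inj₂ x≡) = inj₂ (trans x≡ (sym (sndPt-φ l {c} fst≡)))

  -- The linear form reading off the k-th coordinate of φ⁻¹.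
  coordinateForm : Fin 4 → Point
  coordinateForm k = proj₁ (T-surjective (e k))

  coordinateForm-nonzero : ∀ k → coordinateForm k ≢ 0ᵛ
  coordinateForm-nonzero k f≡0 = e-nonzero k (begin
    e k                   ≡⟨ sym (proj₂ (T-surjective (e k))) ⟩
    T (coordinateForm k)  ≡⟨ cong T f≡0 ⟩
    T 0ᵛ                  ≡⟨ tabulate-cong (λ k → dot-0ˡ (b k)) ⟩
    0ᵛ                    ∎)
    where open ≡-Reasoning

  coordinateHyperplane : Fin 4 → Hyperplane
  coordinateHyperplane k = kernelHyperplane a (coordinateForm k) (coordinateForm-nonzero k)

  aLine-in-coordinateHyperplane : ∀ k (l : ALine a) {c} → fstPt l ≡ φ c → lookup c k ≡ 0F →
                                  LineIn a l (coordinateHyperplane k)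
  aLine-in-coordinateHyperplane k l {c} fst≡ c-k≡0 =
    aLine-in-kernelHyperplane (coordinateForm-nonzero k) l fst≡ (begin
      dot (coordinateForm k) (lincomb c b)  ≡⟨ dot-lincomb (coordinateForm k) c b ⟩
      dot c (T (coordinateForm k))          ≡⟨ cong (dot c) (proj₂ (T-surjective (e k))) ⟩
      dot c (e k)                           ≡⟨ dot-e c k ⟩
      lookup c k                            ≡⟨ c-k≡0 ⟩
      0F                                    ∎)
    where open ≡-Reasoning

  standardLine : Fin 8 → Fin 5 → ALine a
  standardLine i j = aLine (κ i j) (κ-nonzero i j)

  standardDemicap : Fin 8 → PSet
  standardDemicap i x = does (any? λ j → OnLine? x (κ i j))

  ∈-standardDemicap⇒ : ∀ {i x} → x ∈ standardDemicap i → ∃ λ j → OnLine x (κ i j)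
  ∈-standardDemicap⇒ {i} {x} = does⇒witness (any? λ j → OnLine? x (κ i j))

  ∈-standardDemicap⇐ : ∀ {i x j} → OnLine x (κ i j) → x ∈ standardDemicap i
  ∈-standardDemicap⇐ {i} {x} {j} on = dec-true (any? λ j → OnLine? x (κ i j)) (j , on)

  standardDemicap-union : ∀ i → IsUnionOf (standardDemicap i) (standardLine i)
  standardDemicap-union i x = ∈-standardDemicap⇒ {i} {x} , λ j → ∈-standardDemicap⇐ {i} {x} {j}

  standardDemicap-cap : ∀ i → IsCap (standardDemicap i)
  standardDemicap-cap i x y z (x≢y , y≢z , x≢z , sum≡0) x∈ y∈ z∈
    with ∈-standardDemicap⇒ {i} {x} x∈ | ∈-standardDemicap⇒ {i} {y} y∈ | ∈-standardDemicap⇒ {i} {z} z∈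
  ... | m₁ , on₁ | m₂ , on₂ | m₃ , on₃
    with OnLine-coordinates on₁ | OnLine-coordinates on₂ | OnLine-coordinates on₃
  ... | d₁ , refl , d₁≡± | d₂ , refl , d₂≡± | d₃ , refl , d₃≡± =
    κ-cap i (m₁ , d₁≡±) (m₂ , d₂≡±) (m₃ , d₃≡±) (x≢y ∘ cong φ) (y≢z ∘ cong φ) (x≢z ∘ cong φ)
          (φ-reflects-lines sum≡0)

  -- The coordinates of points of H form a linear subspace containing four of the five
  -- directions κ i j, hence all of them, so H would contain the four lines L k.
  standardDemicap-noFour : ∀ i m → ¬ (Σ Hyperplane λ H → ∀ j → j ≢ m → LineIn a (standardLine i j) H)
  standardDemicap-noFour i m (H , inH) = nch (H , L-in-H)
    where
    P : Point → Set
    P c = φ c ∈H H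
    P-closed : LineClosed P
    P-closed = affine-preimage-lineClosed a b (∈H-lineClosed H)
    P-0 : P 0ᵛ
    P-0 = subst (_∈H H) (sym φ-0) (proj₁ (inH (punchIn m 0F) (punchInᵢ≢i m 0F)))
    P-others : ∀ j → j ≢ m → P (κ i j)
    P-others j j≢m = proj₁ (proj₂ (inH j j≢m))
    P-κ : ∀ j → P (κ i j)
    P-κ j with j ≟F m
    ... | no j≢m = P-others j j≢m
    ... | yes refl with κ-spanning i j
    ...   | t , κ≡ =
      subst P (sym κ≡) (lineClosed-lincomb {P = P} P-closed P-0 t {κ i ∘ punchIn j} λ k → P-others (punchIn j k) (punchInᵢ≢i j k))
    L-in-H : ∀ k → LineIn a (L k) H
    L-in-H k = subst (_∈H H) φ-0 P-0 ,
               subst (_∈H H) (φ-e k) (P-κ (suc k)) ,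
               subst (_∈H H) (sym (sndPt-φ (L k) {e k} (sym (φ-e k)))) (lineClosed-neg {P = P} P-closed P-0 {e k} (P-κ (suc k)))

  standardDemicap-isDemicap : ∀ i → IsDemicap a (standardDemicap i)
  standardDemicap-isDemicap i =
    standardDemicap-cap i , standardLine i , standardDemicap-union i , standardDemicap-noFour i

  standardDemicap-contains : ∀ i → ContainsAll L (standardDemicap i)
  standardDemicap-contains i k =
    ∈-standardDemicap⇐ {i} {fstPt (L k)} {suc k} (inj₁ (sym (φ-e k))) ,
    ∈-standardDemicap⇐ {i} {sndPt (L k)} {suc k} (inj₂ (sndPt-φ (L k) {e k} (sym (φ-e k))))

  standardDemicap-distinct : ∀ i i′ → i ≢ i′ → ¬ (standardDemicap i ≐ standardDemicap i′)
  standardDemicap-distinct i i′ i≢i′ same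
    with ∈-standardDemicap⇒ {i′} {φ (ν i)} (trans (sym (same (φ (ν i)))) (∈-standardDemicap⇐ {i} {φ (ν i)} {0F} (inj₁ refl)))
  ... | m , on = ν-separated i i′ i≢i′ m (OnLine-φ {κ i′ m} {ν i} on)

  module Classification (S : PSet) (S-demicap : IsDemicap a S) (L⊆S : ContainsAll L S) where

    L′ : Fin 5 → ALine a
    L′ = proj₁ (proj₂ S-demicap)

    c : Fin 5 → Point
    c j = proj₁ (φ-surjective (fstPt (L′ j)))

    fstPt-L′ : ∀ j → fstPt (L′ j) ≡ φ (c j)
    fstPt-L′ j = sym (proj₂ (φ-surjective (fstPt (L′ j))))

    ∈S⇒OnLine : ∀ {x} → x ∈ S → ∃ λ j → OnLine x (c j)
    ∈S⇒OnLine {x} x∈ =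
      let j , on = proj₁ (proj₁ (proj₂ (proj₂ S-demicap)) x) x∈ in j , aLine⇒OnLine (L′ j) {c j} (fstPt-L′ j) on

    OnLine⇒∈S : ∀ {x} j → OnLine x (c j) → x ∈ S
    OnLine⇒∈S {x} j on = proj₂ (proj₁ (proj₂ (proj₂ S-demicap)) x) j (OnLine⇒aLine (L′ j) {c j} (fstPt-L′ j) on)

    line-through-e : ∀ k → ∃ λ j → e k ≡± c j
    line-through-e k =
      let j , on = ∈S⇒OnLine {fstPt (L k)} (proj₁ (L⊆S k))
      in j , OnLine-φ {c j} {e k} (subst (λ x → OnLine x (c j)) (sym (φ-e k)) on)

    g : Fin 4 → Fin 5
    g k = proj₁ (line-through-e k)

    e≡±c∘g : ∀ k → e k ≡± c (g k)
    e≡±c∘g k = proj₂ (line-through-e k)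

    g-injective : Injective _≡_ _≡_ g
    g-injective {k} {k′} gk≡gk′ =
      e-≡±-injective k k′ (≡±-trans (e≡±c∘g k) (subst (λ j → c j ≡± e k′) (sym gk≡gk′) (≡±-sym (e≡±c∘g k′))))

    r : Fin 5
    r = proj₁ (injection-coversAllButOne g g-injective)

    LineCase : Fin 5 → Set
    LineCase j = j ≡ r ⊎ ∃ λ k → g k ≡ j

    line-cases : ∀ j → LineCase j
    line-cases j = decide (j ≟F r)
      where
      decide : Dec (j ≡ r) → LineCase j
      decide (yes j≡r) = inj₁ j≡r
      decide (no j≢r) = inj₂ (proj₂ (injection-coversAllButOne g g-injective) j j≢r)

    -- Otherwise the four lines of S other than g k lie in the k-th coordinate hyperplane.
    c-r-nonvanishing : ∀ k → lookup (c r) k ≢ 0F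
    c-r-nonvanishing k c-r-k≡0 =
      proj₂ (proj₂ (proj₂ S-demicap)) (g k) (coordinateHyperplane k , λ j j≢gk →
        aLine-in-coordinateHyperplane k (L′ j) {c j} (fstPt-L′ j) (vanishes j j≢gk (line-cases j)))
      where
      vanishes : ∀ j → j ≢ g k → LineCase j → lookup (c j) k ≡ 0F
      vanishes j _ (inj₁ refl) = c-r-k≡0
      vanishes j j≢gk (inj₂ (k′ , refl)) = ≡±e-lookup k′ k (≡±-sym (e≡±c∘g k′)) (j≢gk ∘ cong g)

    classify : ∃ λ i → S ≐ standardDemicap i
    classify = i , λ x → ⇔→≡ {z = true} (mk⇔ (S⊆D ∘ ∈S⇒OnLine {x}) (D⊆S ∘ ∈-standardDemicap⇒ {i} {x}))
      where
      i : Fin 8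
      i = proj₁ (ν-cover (c r) c-r-nonvanishing)
      c-r≡±ν : c r ≡± ν i
      c-r≡±ν = proj₂ (ν-cover (c r) c-r-nonvanishing)
      on-line : ∀ {x j} → OnLine x (c j) → LineCase j → x ∈ standardDemicap i
      on-line {x} on (inj₁ refl) = ∈-standardDemicap⇐ {i} {x} {0F} (OnLine-≡± c-r≡±ν on)
      on-line {x} on (inj₂ (k , refl)) = ∈-standardDemicap⇐ {i} {x} {suc k} (OnLine-≡± (≡±-sym (e≡±c∘g k)) on)
      S⊆D : ∀ {x} → (∃ λ j → OnLine x (c j)) → x ∈ standardDemicap i
      S⊆D (j , on) = on-line on (line-cases j)
      D⊆S : ∀ {x} → (∃ λ j → OnLine x (κ i j)) → x ∈ S
      D⊆S (zero , on) = OnLine⇒∈S r (OnLine-≡± (≡±-sym c-r≡±ν) on)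
      D⊆S (suc k , on) = OnLine⇒∈S (g k) (OnLine-≡± (e≡±c∘g k) on)

corollary3p7 : (a : Point) (L : Fin4ALines a) →
    NotCoHyperplanar4 a L →
    ExactlyN 8 (λ S → IsDemicap a S × ContainsAll L S)
corollary3p7 a L nch =
  standardDemicap , standardDemicap-distinct ,
  (λ i → standardDemicap-isDemicap i , standardDemicap-contains i) ,
  λ S S-properties → Classification.classify S (proj₁ S-properties) (proj₂ S-properties)
  where open Frame a L nch
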